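{- Let $I$ be an instance of SPA-ST and let $J$ be the integer program for $I$ described in the context. If $S$ is a feasible solution to $J$, then $M=\{(s_i,p_j): x_{i,j}=1 \text{ in } S\}$ is a super-stable matching in $I$ with $|M|$ equal to the objective value of $S$. Conversely, if $M$ is a super-stable matching in $I$, then there is a feasible solution $S$ to $J$ with $x_{i,j}=1$ exactly for $(s_i,p_j)\in M$, whose objective value equals $|M|$.
   Context: An instance $I$ of SPA-ST consists of students $s_1,\dots,s_{n_1}$, projects $p_1,\dots,p_{n_2}$ and lecturers $l_1,\dots,l_{n_3}$. Each student $s_i$ has a set $A_i$ of acceptable projects ranked as a strict ranking of ties (a tie is a set of equally preferred entries). Each lecturer $l_k$ offers a non-empty set $P_k$ of projects, the $P_k$ partitioning the projects; $l_k$ has capacity $d_k\in\mathbb{Z}^+$ and a preference list $\mathcal{L}_k$ ranking, as a strict ranking of ties, exactly those students finding some project in $P_k$ acceptable; $\mathcal{L}_k^j$ is $\mathcal{L}_k$ restricted to students finding $p_j$ acceptable. Project $p_j$ has capacity $c_j\in\mathbb{Z}^+$, and $\max\{c_j:p_j\in P_k\}\le d_k\le\sum_{p_j\in P_k}c_j$. A matching is a set $M$ of acceptable pairs with each student in at most one pair, $|M(p_j)|\le c_j$, $|M(l_k)|\le d_k$ ($M(p_j)$: students assigned to $p_j$; $M(l_k)$: students assigned to projects of $P_k$). Undersubscribed/full means fewer than/exactly capacity many assignees. With $l_k$ the lecturer offering $p_j$, $M$ is super-stable if no acceptable pair $(s_i,p_j)\notin M$ satisfies: (a) $s_i$ is unassigned,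 or prefers $p_j$ to $M(s_i)$ or is indifferent between them, and (b) either (i) $p_j$ and $l_k$ are undersubscribed, or (ii) $p_j$ is undersubscribed, $l_k$ is full and either $s_i\in M(l_k)$ or $l_k$ prefers $s_i$ to a worst student in $M(l_k)$ or is indifferent between them, or (iii) $p_j$ is full and $l_k$ prefers $s_i$ to a worst student in $M(p_j)$ or is indifferent between them. Ranks: $\mathrm{rank}(s_i,p_j)=1+$ the number of projects $s_i$ strictly prefers to $p_j$; $\mathrm{rank}(l_k,s_i)=1+$ the number of students $l_k$ strictly prefers to $s_i$. For acceptable $(s_i,p_j)$ with $p_j\in P_k$: $S_{i,j}=\{p_{j'}\in A_i:\mathrm{rank}(s_i,p_{j'})<\mathrm{rank}(s_i,p_j)\}$, $T_{i,j,k}=\{s_{i'}\in\mathcal{L}_k^j:\mathrm{rank}(l_k,s_{i'})<\mathrm{rank}(l_k,s_i)\}$, $D_{i,k}=\{s_{i'}\in\mathcal{L}_k:\mathrm{rank}(l_k,s_{i'})<\mathrm{rank}(l_k,s_i)\}$. (Sums $\sum_{i'}x_{i',j}$ range over students for whom $p_j$ is acceptable.) The IP $J$ has binary variables $x_{i,j}$ for each acceptable pair $(s_i,p_j)$, $\alpha_j,\gamma_j$ for each project, $\beta_k,\eta_k$ for each lecturer, and $\delta_{i,k}$, $\lambda_{i,j,k}$ for each acceptable pair $(s_i,p_j)$ with $p_j\in P_k$. Constraints: $\sum_{p_j\in A_i}x_{i,j}\le 1$ for each $i$; $\sum_{i'}x_{i',j}\le c_j$ for each $j$; $\sum_{i'}\sum_{p_{j'}\in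 P_k}x_{i',j'}\le d_k$ for each $k$; and for every acceptable pair $(s_i,p_j)$ with $p_j\in P_k$, writing $\theta_{i,j}=1-x_{i,j}-\sum_{p_{j'}\in S_{i,j}}x_{i,j'}$: $c_j\alpha_j\ge c_j-\sum_{i'}x_{i',j}$; $d_k\beta_k\ge d_k-\sum_{i'}\sum_{p_{j'}\in P_k}x_{i',j'}$; $\theta_{i,j}+\alpha_j+\beta_k\le 2$; $d_k\eta_k\ge\big(1+\sum_{i'}\sum_{p_{j'}\in P_k}x_{i',j'}\big)-d_k$; $d_k\delta_{i,k}\ge\sum_{i'}\sum_{p_{j'}\in P_k}x_{i',j'}-\sum_{s_{i'}\in D_{i,k}}\sum_{p_{j'}\in P_k}x_{i',j'}$; $\theta_{i,j}+\alpha_j+\eta_k+\delta_{i,k}\le 3$; $c_j\gamma_j\ge\big(1+\sum_{i'}x_{i',j}\big)-c_j$; $c_j\lambda_{i,j,k}\ge\sum_{i'}x_{i',j}-\sum_{s_{i'}\in T_{i,j,k}}x_{i',j}$; $\theta_{i,j}+\gamma_j+\lambda_{i,j,k}\le 2$. Objective: maximise $\sum_{i}\sum_{p_j\in A_i}x_{i,j}$. -}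

module Defs where

open import Data.Bool using (Bool; true; false; _∧_; _∨_)
open import Data.Nat as ℕ using (ℕ; zero; suc; _<?_)
open import Data.Integer as ℤ using (ℤ; +_)
open import Data.Fin using (Fin; _≟_)
import Data.Fin as F
open import Data.Product using (Σ; ∃; _×_; _,_)
open import Data.Sum using (_⊎_)
open import Data.Empty using (⊥)
open import Relation.Nullary using (¬_; does)
open import Relation.Binary.PropositionalEquality using (_≡_)

sumℕ : ∀ {n} → (Fin n → ℕ) → ℕ
sumℕ {zero}  f = 0
sumℕ {suc n} f = f F.zero ℕ.+ sumℕ (λ i → f (F.suc i))

anyF : ∀ {n} → (Fin n → Bool) → Bool
anyF {zero}  f = false
anyF {suc n} f = f F.zero ∨ anyF (λ i → f (F.suc i))

b2n : Bool → ℕ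
b2n true  = 1
b2n false = 0

b2z : Bool → ℤ
b2z b = + b2n b

-- Students Fin n1, projects Fin n2, lecturers Fin n3.
-- acc i j : p_j ∈ A_i.
-- slev i j : tie level of p_j in s_i's list (smaller = better); only
--   meaningful for acceptable p_j. This encodes a strict ranking of ties.
-- offers j : the lecturer offering p_j (so the P_k partition the projects).
-- llev k i : tie level of s_i in l_k's list (smaller = better); only
--   meaningful for s_i in L_k (students finding some project of P_k
--   acceptable); L_k itself is determined by acc and offers.

record Instance : Set where
  field
    n1 n2 n3 : ℕ
    acc      : Fin n1 → Fin n2 → Bool
    slev     : Fin n1 → Fin n2 → ℕ
    offers   : Fin n2 → Fin n3
    llev     : Fin n3 → Fin n1 → ℕ
    cap      : Fin n2 → ℕ
    lcap     : Fin n3 → ℕ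
    Pk-nonempty : ∀ k → ∃ λ j → offers j ≡ k
    cap-pos  : ∀ j → 1 ℕ.≤ cap j
    lcap-pos : ∀ k → 1 ℕ.≤ lcap k
    cap≤lcap : ∀ j → cap j ℕ.≤ lcap (offers j)
    lcap≤sum : ∀ k → lcap k ℕ.≤ sumℕ (λ j → b2n (does (offers j ≟ k)) ℕ.* cap j)

module _ (I : Instance) where
  open Instance I

  offeredBy : Fin n2 → Fin n3 → Bool
  offeredBy j k = does (offers j ≟ k)

  inL : Fin n3 → Fin n1 → Bool
  inL k i = anyF (λ j → offeredBy j k ∧ acc i j)

  Pairs : Set
  Pairs = Fin n1 → Fin n2 → Bool

  cntP : Pairs → Fin n2 → ℕ
  cntP M j = sumℕ (λ i → b2n (M i j))

  rowL : Pairs → Fin n3 → Fin n1 → ℕ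
  rowL M k i = sumℕ (λ j → b2n (offeredBy j k ∧ M i j))

  cntL : Pairs → Fin n3 → ℕ
  cntL M k = sumℕ (λ i → rowL M k i)

  size : Pairs → ℕ
  size M = sumℕ (λ i → sumℕ (λ j → b2n (M i j)))

  record IsMatching (M : Pairs) : Set where
    field
      acceptable : ∀ i j → M i j ≡ true → acc i j ≡ true
      oneEach    : ∀ i j j' → M i j ≡ true → M i j' ≡ true → j ≡ j'
      projCap    : ∀ j → cntP M j ℕ.≤ cap j
      lectCap    : ∀ k → cntL M k ℕ.≤ lcap k

  InMP : Pairs → Fin n2 → Fin n1 → Set
  InMP M j i = M i j ≡ true

  InML : Pairs → Fin n3 → Fin n1 → Set
  InML M k i = Σ (Fin n2) λ j' → (offers j' ≡ k) × (M i j' ≡ true)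

  AtLeastWorst : Fin n3 → (Fin n1 → Set) → Fin n1 → Set
  AtLeastWorst k S i =
    Σ (Fin n1) λ w → S w × (∀ s' → S s' → llev k s' ℕ.≤ llev k w)
                         × (llev k i ℕ.≤ llev k w)

  -- (s_i, p_j) blocks M (condition on (s_i,p_j) ∉ M acceptable is
  -- imposed in SuperStable)
  Blocks : Pairs → Fin n1 → Fin n2 → Set
  Blocks M i j =
    ((∀ j' → M i j' ≡ false) ⊎
     (Σ (Fin n2) λ j' → (M i j' ≡ true) × (slev i j ℕ.≤ slev i j')))
    ×
    ((cntP M j ℕ.< cap j × cntL M (offers j) ℕ.< lcap (offers j))
     ⊎ (cntP M j ℕ.< cap j × cntL M (offers j) ≡ lcap (offers j)
         × (InML M (offers j) i ⊎ AtLeastWorst (offers j) (InML M (offers j)) i))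
     ⊎ (cntP M j ≡ cap j × AtLeastWorst (offers j) (InMP M j) i))

  SuperStable : Pairs → Set
  SuperStable M = IsMatching M ×
    (∀ i j → acc i j ≡ true → M i j ≡ false → ¬ Blocks M i j)

  rankS : Fin n1 → Fin n2 → ℕ
  rankS i j = suc (sumℕ (λ j' → b2n (acc i j' ∧ does (slev i j' <? slev i j))))

  rankL : Fin n3 → Fin n1 → ℕ
  rankL k i = suc (sumℕ (λ i' → b2n (inL k i' ∧ does (llev k i' <? llev k i))))

  inS : Fin n1 → Fin n2 → Fin n2 → Bool
  inS i j j' = acc i j' ∧ does (rankS i j' <? rankS i j)

  inT : Fin n1 → Fin n2 → Fin n1 → Bool
  inT i j i' = acc i' j ∧ does (rankL (offers j) i' <? rankL (offers j) i)

  inD : Fin n1 → Fin n3 → Fin n1 → Bool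
  inD i k i' = inL k i' ∧ does (rankL k i' <? rankL k i)

  -- Binary variables are Booleans (true = 1).
  -- x is given on all pairs but only its values on acceptable pairs are
  -- variables of J: every sum below ranges over acceptable pairs only.
  -- δ is indexed by (i,k) and λ by (i,j) (k being determined by j).

  record Solution : Set where
    field
      x : Fin n1 → Fin n2 → Bool
      α γ : Fin n2 → Bool
      β η : Fin n3 → Bool
      δ : Fin n1 → Fin n3 → Bool
      λv : Fin n1 → Fin n2 → Bool

  module _ (S : Solution) where
    open Solution S

    xa : Fin n1 → Fin n2 → ℕ
    xa i j = b2n (acc i j ∧ x i j)

    sumP : Fin n2 → ℕ
    sumP j = sumℕ (λ i' → xa i' j)

    rowX : Fin n3 → Fin n1 → ℕ
    rowX k i' = sumℕ (λ j' → b2n (offeredBy j' k) ℕ.* xa i' j')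

    sumLX : Fin n3 → ℕ
    sumLX k = sumℕ (λ i' → rowX k i')

    θ : Fin n1 → Fin n2 → ℤ
    θ i j = (+ 1 ℤ.- + xa i j) ℤ.- + sumℕ (λ j' → b2n (inS i j j') ℕ.* xa i j')

    PairConstraints : Fin n1 → Fin n2 → Set
    PairConstraints i j =
      let k = offers j
          cj = + cap j
          dk = + lcap k
          sP = + sumP j
          sL = + sumLX k
      in (cj ℤ.* b2z (α j) ℤ.≥ cj ℤ.- sP)
       × (dk ℤ.* b2z (β k) ℤ.≥ dk ℤ.- sL)
       × (θ i j ℤ.+ b2z (α j) ℤ.+ b2z (β k) ℤ.≤ + 2)
       × (dk ℤ.* b2z (η k) ℤ.≥ (+ 1 ℤ.+ sL) ℤ.- dk)
       × (dk ℤ.* b2z (δ i k) ℤ.≥ sL ℤ.- + sumℕ (λ i' → b2n (inD i k i') ℕ.* rowX k i'))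
       × (θ i j ℤ.+ b2z (α j) ℤ.+ b2z (η k) ℤ.+ b2z (δ i k) ℤ.≤ + 3)
       × (cj ℤ.* b2z (γ j) ℤ.≥ (+ 1 ℤ.+ sP) ℤ.- cj)
       × (cj ℤ.* b2z (λv i j) ℤ.≥ sP ℤ.- + sumℕ (λ i' → b2n (inT i j i') ℕ.* xa i' j))
       × (θ i j ℤ.+ b2z (γ j) ℤ.+ b2z (λv i j) ℤ.≤ + 2)

    record Feasible : Set where
      field
        studentC : ∀ i → sumℕ (λ j → xa i j) ℕ.≤ 1
        projectC : ∀ j → sumP j ℕ.≤ cap j
        lecturerC : ∀ k → sumLX k ℕ.≤ lcap k
        pairC : ∀ i j → acc i j ≡ true → PairConstraints i j

    objective : ℕ
    objective = sumℕ (λ i → sumℕ (λ j → xa i j))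

    matchingOf : Pairs
    matchingOf i j = acc i j ∧ x i j

module Submission where

-- Every auxiliary variable of J linearises a strict inequality between two
-- loads by a "big-M" constraint  c·bit ≥ a - t,  and θ_{i,j} is the bit
-- "s_i holds neither p_j nor a project it strictly prefers".  The three
-- θ-constraints then say that θ_{i,j} = 1 never coexists with the indicators
-- of conditions (b)(i), (b)(ii), (b)(iii) of a blocking pair.
--
-- Direction 1
-- reads a blocking pair off a feasible solution and contradicts a θ-constraint;
-- direction 2 sets every indicator to the truth value of its inequality.

open import Defs
open import Data.Bool using (Bool; true; false; _∧_)
import Data.Bool.Properties as BP
open import Data.Nat as ℕ using (ℕ; zero; suc; _<?_; z≤n; s≤s; _≤_; _<_; _+_; _*_; _∸_)
import Data.Nat.Properties as NP
open import Data.Integer as ℤ using (+_)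
import Data.Integer.Properties as ZP
open import Data.Fin using (Fin)
import Data.Fin as F
import Data.Fin.Properties as FP
open import Data.List using (List; filter; allFin)
open import Data.List.Membership.Propositional.Properties using (∈-filter⁺; ∈-allFin)
import Data.List.Relation.Unary.All as All
open import Data.List.Relation.Unary.All.Properties using (all-filter)
import Data.List.Extrema NP.≤-totalOrder as Extrema
open import Algebra.Properties.CommutativeSemigroup NP.+-commutativeSemigroup using (x∙yz≈y∙xz)
open import Data.Product using (Σ; ∃; _×_; _,_; proj₁; proj₂)
open import Data.Sum using (_⊎_; inj₁; inj₂)
open import Data.Empty using (⊥; ⊥-elim)
open import Function using (_∘_)
open import Relation.Nullary using (¬_; does; yes; no; Dec; contradiction)
open import Relation.Nullary.Decidable using (dec-true; dec-false; _×-dec_)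
open import Relation.Unary using (Decidable)
open import Relation.Binary.PropositionalEquality

does-true : ∀ {P : Set} (d : Dec P) → does d ≡ true → P
does-true (yes p) _ = p

does-false : ∀ {P : Set} (d : Dec P) → does d ≡ false → ¬ P
does-false (no ¬p) _ = ¬p

not-true : ∀ {b} → ¬ b ≡ true → b ≡ false
not-true {true}  ¬t = contradiction refl ¬t
not-true {false} _  = refl

∧-true : ∀ {a b} → a ∧ b ≡ true → a ≡ true × b ≡ true
∧-true {true} {true} _ = refl , refl

∧-false : ∀ a {b} → b ≡ false → a ∧ b ≡ false
∧-false a refl = BP.∧-zeroʳ a

b2n-∧ : ∀ a b → b2n (a ∧ b) ≡ b2n a * b2n b
b2n-∧ true  b = sym (NP.+-identityʳ (b2n b))
b2n-∧ false b = refl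

b2n≤1 : ∀ b → b2n b ≤ 1
b2n≤1 true  = s≤s z≤n
b2n≤1 false = z≤n

b2n-pos : ∀ {b} → 0 < b2n b → b ≡ true
b2n-pos {true} _ = refl

masked-term-pos : ∀ b x → 0 < b2n b * x → b ≡ true × 0 < x
masked-term-pos true x pos = refl , subst (0 <_) (NP.*-identityˡ x) pos

masked-term≤ : ∀ b x → b2n b * x ≤ x
masked-term≤ true  x = NP.≤-reflexive (NP.*-identityˡ x)
masked-term≤ false x = z≤n

sum-cong : ∀ {n} {f g : Fin n → ℕ} → (∀ i → f i ≡ g i) → sumℕ f ≡ sumℕ g
sum-cong {zero}  _   = refl
sum-cong {suc n} f≗g = cong₂ _+_ (f≗g F.zero) (sum-cong (f≗g ∘ F.suc))

sum-mono : ∀ {n} {f g : Fin n → ℕ} → (∀ i → f i ≤ g i) → sumℕ f ≤ sumℕ g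
sum-mono {zero}  _   = z≤n
sum-mono {suc n} f≤g = NP.+-mono-≤ (f≤g F.zero) (sum-mono (f≤g ∘ F.suc))

sum-strict : ∀ {n} {f g : Fin n → ℕ} → (∀ i → f i ≤ g i) → ∀ j → f j < g j → sumℕ f < sumℕ g
sum-strict {suc n} f≤g F.zero    lt = NP.+-mono-<-≤ lt (sum-mono (f≤g ∘ F.suc))
sum-strict {suc n} f≤g (F.suc j) lt = NP.+-mono-≤-< (f≤g F.zero) (sum-strict (f≤g ∘ F.suc) j lt)

sum-zeros : ∀ n → sumℕ {n} (λ _ → 0) ≡ 0
sum-zeros zero    = refl
sum-zeros (suc n) = sum-zeros n

term≤sum : ∀ {n} (f : Fin n → ℕ) j → f j ≤ sumℕ f
term≤sum f F.zero    = NP.m≤m+n _ _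
term≤sum f (F.suc j) = NP.≤-trans (term≤sum (f ∘ F.suc) j) (NP.m≤n+m _ _)

two-terms≤sum : ∀ {n} (f : Fin n → ℕ) {j j'} → j ≢ j' → f j + f j' ≤ sumℕ f
two-terms≤sum f {F.zero}  {F.zero}   j≢j' = contradiction refl j≢j'
two-terms≤sum f {F.zero}  {F.suc j'} _    = NP.+-monoʳ-≤ (f F.zero) (term≤sum (f ∘ F.suc) j')
two-terms≤sum f {F.suc j} {F.zero}   _    =
  subst (_≤ sumℕ f) (NP.+-comm (f F.zero) _) (NP.+-monoʳ-≤ (f F.zero) (term≤sum (f ∘ F.suc) j))
two-terms≤sum f {F.suc j} {F.suc j'} j≢j' =
  NP.≤-trans (two-terms≤sum (f ∘ F.suc) (j≢j' ∘ cong F.suc)) (NP.m≤n+m _ _)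

sum-<⇒term-< : ∀ {n} {h f : Fin n → ℕ} → sumℕ h < sumℕ f → ∃ λ i → h i < f i
sum-<⇒term-< {h = h} {f} lt with FP.any? (λ i → h i <? f i)
... | yes found = found
... | no none   = contradiction (sum-mono λ i → NP.≮⇒≥ λ lt' → none (i , lt')) (NP.<⇒≱ lt)

sum-pos : ∀ {n} {f : Fin n → ℕ} → 0 < sumℕ f → ∃ λ i → 0 < f i
sum-pos {n} {f} pos = sum-<⇒term-< (subst (_< sumℕ f) (sym (sum-zeros n)) pos)

sum-split : ∀ {n} {h f : Fin n → ℕ} → (∀ i → h i ≤ f i) → ∀ j → h j ≡ 0 → f j + sumℕ h ≤ sumℕ f
sum-split {suc n} {h} {f} h≤f F.zero h₀≡0 = begin
  f F.zero + (h F.zero + sumℕ (h ∘ F.suc)) ≡⟨ cong (λ t → f F.zero + (t + sumℕ (h ∘ F.suc))) h₀≡0 ⟩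
  f F.zero + sumℕ (h ∘ F.suc)              ≤⟨ NP.+-monoʳ-≤ (f F.zero) (sum-mono (h≤f ∘ F.suc)) ⟩
  sumℕ f                                   ∎
  where open NP.≤-Reasoning
sum-split {suc n} {h} {f} h≤f (F.suc j) hj≡0 = begin
  f (F.suc j) + (h F.zero + sumℕ (h ∘ F.suc)) ≡⟨ x∙yz≈y∙xz (f (F.suc j)) (h F.zero) _ ⟩
  h F.zero + (f (F.suc j) + sumℕ (h ∘ F.suc)) ≤⟨ NP.+-mono-≤ (h≤f F.zero) (sum-split (h≤f ∘ F.suc) j hj≡0) ⟩
  sumℕ f                                      ∎
  where open NP.≤-Reasoning

AtMostOne : ∀ {n} → (Fin n → Bool) → Set
AtMostOne b = ∀ j j' → b j ≡ true → b j' ≡ true → j ≡ j'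

atMostOne⇒sum≤1 : ∀ {n} (b : Fin n → Bool) → AtMostOne b → sumℕ (b2n ∘ b) ≤ 1
atMostOne⇒sum≤1 {zero}  b _ = z≤n
atMostOne⇒sum≤1 {suc n} b one with b F.zero in b₀
... | false = atMostOne⇒sum≤1 (b ∘ F.suc) λ j j' p q → FP.suc-injective (one _ _ p q)
... | true  = s≤s (NP.≮⇒≥ λ pos → let (j , bj) = sum-pos pos in
                 zero≢suc (one F.zero (F.suc j) b₀ (b2n-pos bj)))
  where
  zero≢suc : ∀ {j} → ¬ F.zero ≡ F.suc {n} j
  zero≢suc ()

sum≤1⇒atMostOne : ∀ {n} (b : Fin n → Bool) → sumℕ (b2n ∘ b) ≤ 1 → AtMostOne b
sum≤1⇒atMostOne b ≤1 j j' bj bj' with j F.≟ j'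
... | yes j≡j' = j≡j'
... | no  j≢j' = contradiction (NP.≤-trans (two-terms≤sum (b2n ∘ b) j≢j') ≤1) (two≰1 bj bj')
  where
  two≰1 : ∀ {p q} → p ≡ true → q ≡ true → ¬ b2n p + b2n q ≤ 1
  two≰1 refl refl (s≤s ())

-- The part of Σ f whose indices are selected by the mask g.  The sums of J
-- over S_{i,j}, T_{i,j,k} and D_{i,k} are masked sums.
masked : ∀ {n} → (Fin n → Bool) → (Fin n → ℕ) → ℕ
masked g f = sumℕ (λ i → b2n (g i) * f i)

masked-split : ∀ {n} (g : Fin n → Bool) (f : Fin n → ℕ) {j} → g j ≡ false → f j + masked g f ≤ sumℕ f
masked-split g f {j} gj = sum-split (λ i → masked-term≤ (g i) (f i)) j (cong (λ b → b2n b * f j) gj)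

masked≡0⁺ : ∀ {n} (g : Fin n → Bool) (f : Fin n → ℕ) → (∀ j → g j ≡ true → ¬ 0 < f j) → masked g f ≡ 0
masked≡0⁺ g f empty = NP.n≤0⇒n≡0 (NP.≮⇒≥ λ pos →
  let (j , term) = sum-pos pos ; (gj , fj) = masked-term-pos (g j) (f j) term in empty j gj fj)

masked≡0⁻ : ∀ {n} (g : Fin n → Bool) (f : Fin n → ℕ) → masked g f ≡ 0 → ∀ {j} → g j ≡ true → ¬ 0 < f j
masked≡0⁻ g f zero-sum {j} gj pos =
  NP.<-irrefl (sym zero-sum) (NP.<-≤-trans selected-pos (term≤sum (λ i → b2n (g i) * f i) j))
  where
  selected-pos : 0 < b2n (g j) * f j
  selected-pos = subst (λ b → 0 < b2n b * f j) (sym gj) (subst (0 <_) (sym (NP.*-identityˡ (f j))) pos)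

masked-<⁺ : ∀ {n} (g : Fin n → Bool) (f : Fin n → ℕ) {j} → g j ≡ false → 0 < f j → masked g f < sumℕ f
masked-<⁺ g f gj pos = NP.<-≤-trans (NP.m<n+m _ pos) (masked-split g f gj)

masked-<⁻ : ∀ {n} (g : Fin n → Bool) (f : Fin n → ℕ) → masked g f < sumℕ f → ∃ λ j → g j ≡ false × 0 < f j
masked-<⁻ g f lt with sum-<⇒term-< lt
... | j , term-< with g j in gj
...   | false = j , gj , term-<
...   | true  = contradiction term-< (NP.<-irrefl (NP.+-identityʳ (f j)))

anyF-intro : ∀ {n} (f : Fin n → Bool) j → f j ≡ true → anyF f ≡ true
anyF-intro f F.zero    fj rewrite fj = refl
anyF-intro f (F.suc j) fj rewrite anyF-intro (f ∘ F.suc) j fj = BP.∨-zeroʳ (f F.zero)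

-- rank = 1 + the number of admissible entries (P) at a strictly smaller level (v).
-- rankS i and rankL k are rankBy (acc i) (slev i) and rankBy (inL k) (llev k).
countBelow : ∀ {n} → (Fin n → Bool) → (Fin n → ℕ) → ℕ → ℕ
countBelow P v x = sumℕ (λ j → b2n (P j ∧ does (v j <? x)))

rankBy : ∀ {n} → (Fin n → Bool) → (Fin n → ℕ) → Fin n → ℕ
rankBy P v a = suc (countBelow P v (v a))

module _ {n} (P : Fin n → Bool) (v : Fin n → ℕ) where

  private
    below-mono : ∀ p {a x y} → x ≤ y → (d : Dec (a < x)) (e : Dec (a < y)) → b2n (p ∧ does d) ≤ b2n (p ∧ does e)
    below-mono false _  _         _         = z≤n
    below-mono true  _  (no _)    _         = z≤n
    below-mono true  _  (yes _)   (yes _)   = s≤s z≤n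
    below-mono true  le (yes a<x) (no a≮y)  = contradiction (NP.<-≤-trans a<x le) a≮y

  countBelow-mono : ∀ {x y} → x ≤ y → countBelow P v x ≤ countBelow P v y
  countBelow-mono {x} {y} le = sum-mono λ j → below-mono (P j) le (v j <? x) (v j <? y)

  countBelow-strict : ∀ {x} j → P j ≡ true → v j < x → countBelow P v (v j) < countBelow P v x
  countBelow-strict {x} j Pj lt = sum-strict (λ i → below-mono (P i) (NP.<⇒≤ lt) (v i <? v j) (v i <? x)) j
    (subst₂ _<_ (cong b2n (sym (∧-false (P j) (dec-false (v j <? v j) (NP.<-irrefl refl)))))
                (cong b2n (sym (cong₂ _∧_ Pj (dec-true (v j <? x) lt))))
                (s≤s z≤n))

  not-ranked-above : ∀ {a b} q → v a ≤ v b → q ∧ does (rankBy P v b <? rankBy P v a) ≡ false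
  not-ranked-above q le = ∧-false q (dec-false (_ <? _) (NP.≤⇒≯ (s≤s (countBelow-mono le))))

  level-≤ : ∀ {a b} {q} → P b ≡ true → q ≡ true → q ∧ does (rankBy P v b <? rankBy P v a) ≡ false → v a ≤ v b
  level-≤ {a} {b} Pb refl notAbove = NP.≮⇒≥ λ lt →
    does-false (rankBy P v b <? rankBy P v a) notAbove (s≤s (countBelow-strict b Pb lt))

maximal : ∀ {n} {X : Fin n → Set} → Decidable X → (v : Fin n → ℕ) → ∀ {w} → X w →
          ∃ λ u → X u × (∀ s → X s → v s ≤ v u)
maximal {n} {X} X? v {w} Xw = u , Extrema.argmax-all v Xw (all-filter X? (allFin n)) , bound
  where
  candidates : List (Fin n)
  candidates = filter X? (allFin n)
  u : Fin n
  u = Extrema.argmax v w candidates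
  bound : ∀ s → X s → v s ≤ v u
  bound s Xs = All.lookup (Extrema.f[xs]≤f[argmax] w candidates) (∈-filter⁺ X? (∈-allFin s) Xs)

diff≤⇒∸≤ : ∀ a t m → + a ℤ.- + t ℤ.≤ + m → a ∸ t ≤ m
diff≤⇒∸≤ a t m le rewrite ZP.m-n≡m⊖n a t with t ℕ.≤? a
... | yes t≤a rewrite ZP.⊖-≥ t≤a = ZP.drop‿+≤+ le
... | no  t≰a rewrite NP.m≤n⇒m∸n≡0 (NP.<⇒≤ (NP.≰⇒> t≰a)) = z≤n

∸≤⇒diff≤ : ∀ a t m → a ∸ t ≤ m → + a ℤ.- + t ℤ.≤ + m
∸≤⇒diff≤ a t m le rewrite ZP.m-n≡m⊖n a t with t ℕ.≤? a
... | yes t≤a rewrite ZP.⊖-≥ t≤a = ℤ.+≤+ le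
... | no  t≰a rewrite ZP.⊖-< (NP.≰⇒> t≰a) = ZP.neg-≤-pos

scale-bit : ∀ c b → + c ℤ.* b2z b ≡ + (c * b2n b)
scale-bit c b = ZP.+◃n≡+n (c * b2n b)

indicator-sound : ∀ c a t → a ∸ t ≤ c → (d : Dec (t < a)) → + c ℤ.* b2z (does d) ℤ.≥ + a ℤ.- + t
indicator-sound c a t h d rewrite scale-bit c (does d) = ∸≤⇒diff≤ a t _ (bound d)
  where
  bound : (d : Dec (t < a)) → a ∸ t ≤ c * b2n (does d)
  bound (yes _)   = subst (a ∸ t ≤_) (sym (NP.*-identityʳ c)) h
  bound (no  t≮a) = subst (_≤ c * 0) (sym (NP.m≤n⇒m∸n≡0 (NP.≮⇒≥ t≮a))) z≤n

indicator-forced : ∀ c a t b → + c ℤ.* b2z b ℤ.≥ + a ℤ.- + t → t < a → b ≡ true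
indicator-forced c a t true  _ _   = refl
indicator-forced c a t false h t<a = contradiction (NP.n≤0⇒n≡0 a∸t≤0) (NP.m>n⇒m∸n≢0 t<a)
  where
  a∸t≤0 : a ∸ t ≤ 0
  a∸t≤0 = subst (a ∸ t ≤_) (NP.*-zeroʳ c) (diff≤⇒∸≤ a t _ (subst (_ ℤ.≤_) (scale-bit c false) h))

θ-bit : ∀ a b → a + b ≤ 1 → (+ 1 ℤ.- + a) ℤ.- + b ≡ b2z (does (a + b ℕ.≟ 0))
θ-bit zero          zero          _         = refl
θ-bit zero          (suc zero)    _         = refl
θ-bit (suc zero)    zero          _         = refl
θ-bit zero          (suc (suc _)) (s≤s ())
θ-bit (suc zero)    (suc _)       (s≤s ())
θ-bit (suc (suc _)) _             (s≤s ())

θ-bit-set : ∀ a b → does (a + b ℕ.≟ 0) ≡ true → a ≡ 0 × b ≡ 0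
θ-bit-set a b set = let sum≡0 = does-true (a + b ℕ.≟ 0) set in NP.m+n≡0⇒m≡0 a sum≡0 , NP.m+n≡0⇒n≡0 a sum≡0

bits3-≤ : ∀ u p q → (u ≡ true → p ≡ true → q ≡ true → ⊥) → b2z u ℤ.+ b2z p ℤ.+ b2z q ℤ.≤ + 2
bits3-≤ false p     q     _   = ℤ.+≤+ (NP.+-mono-≤ (b2n≤1 p) (b2n≤1 q))
bits3-≤ true  false q     _   = ℤ.+≤+ (s≤s (b2n≤1 q))
bits3-≤ true  true  false _   = ℤ.+≤+ NP.≤-refl
bits3-≤ true  true  true  all = ⊥-elim (all refl refl refl)

bits3-violated : ∀ {t p q} → t ≡ + 1 → p ≡ true → q ≡ true → ¬ t ℤ.+ b2z p ℤ.+ b2z q ℤ.≤ + 2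
bits3-violated refl refl refl (ℤ.+≤+ (s≤s (s≤s ())))

bits4-≤ : ∀ u p q r → (u ≡ true → p ≡ true → q ≡ true → r ≡ true → ⊥) →
          b2z u ℤ.+ b2z p ℤ.+ b2z q ℤ.+ b2z r ℤ.≤ + 3
bits4-≤ false p     q     r     _   = ℤ.+≤+ (NP.+-mono-≤ (NP.+-mono-≤ (b2n≤1 p) (b2n≤1 q)) (b2n≤1 r))
bits4-≤ true  false q     r     _   = ℤ.+≤+ (s≤s (NP.+-mono-≤ (b2n≤1 q) (b2n≤1 r)))
bits4-≤ true  true  false r     _   = ℤ.+≤+ (s≤s (s≤s (b2n≤1 r)))
bits4-≤ true  true  true  false _   = ℤ.+≤+ NP.≤-refl
bits4-≤ true  true  true  true  all = ⊥-elim (all refl refl refl refl)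

bits4-violated : ∀ {t p q r} → t ≡ + 1 → p ≡ true → q ≡ true → r ≡ true →
                 ¬ t ℤ.+ b2z p ℤ.+ b2z q ℤ.+ b2z r ℤ.≤ + 3
bits4-violated refl refl refl refl (ℤ.+≤+ (s≤s (s≤s (s≤s ()))))

saturated : ∀ {c t} → t ≡ c → c < suc t
saturated t≡c = s≤s (NP.≤-reflexive (sym t≡c))

overflow-bound : ∀ {c t} → 1 ≤ c → t ≤ c → suc t ∸ c ≤ c
overflow-bound {c} {t} 1≤c t≤c =
  NP.≤-trans (NP.∸-monoˡ-≤ c (s≤s t≤c)) (NP.≤-trans (NP.≤-reflexive (NP.m+n∸n≡m 1 c)) 1≤c)

module _ (I : Instance) where
  open Instance I

  Covets : Pairs I → Fin n1 → Fin n2 → Set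
  Covets M i j = (∀ j' → M i j' ≡ false) ⊎ (Σ (Fin n2) λ j' → (M i j' ≡ true) × (slev i j ℕ.≤ slev i j'))

  WouldAccept : Pairs I → Fin n1 → Fin n2 → Set
  WouldAccept M i j =
    (cntP I M j < cap j × cntL I M (offers j) < lcap (offers j))
    ⊎ (cntP I M j < cap j × cntL I M (offers j) ≡ lcap (offers j)
        × (InML I M (offers j) i ⊎ AtLeastWorst I (offers j) (InML I M (offers j)) i))
    ⊎ (cntP I M j ≡ cap j × AtLeastWorst I (offers j) (InMP I M j) i)

  -- S encodes M: the variable x_{i,j} of every acceptable pair is the indicator of (s_i,p_j) ∈ M,
  -- and M uses acceptable pairs only.
  Represents : Solution I → Pairs I → Set
  Represents S M = ∀ i j → xa I S i j ≡ b2n (M i j)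

  offeredBy-true : ∀ {j k} → offers j ≡ k → offeredBy I j k ≡ true
  offeredBy-true {j} {k} = dec-true (offers j F.≟ k)

  inL-of-assigned : ∀ {M k w} → IsMatching I M → InML I M k w → inL I k w ≡ true
  inL-of-assigned {w = w} isM (j , e , m) =
    anyF-intro _ j (cong₂ _∧_ (offeredBy-true e) (IsMatching.acceptable isM w j m))

  atLeastWorst-intro : ∀ {k i w} {X : Fin n1 → Set} → Decidable X → X w → llev k i ≤ llev k w →
                       AtLeastWorst I k X i
  atLeastWorst-intro {k} X? Xw le = let (u , Xu , worst) = maximal X? (llev k) Xw in
    u , Xu , worst , NP.≤-trans le (worst _ Xw)

  -- The masked sums of J.  betterLoad is Σ_{p_j' ∈ S_{i,j}} x_{i,j'}, so that
  -- θ_{i,j} = 1 - x_{i,j} - betterLoad S i j; aboveL and aboveP are the loads on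
  -- l_k and on p_j of the students l_k ranks strictly above s_i (D_{i,k}, T_{i,j,k}).
  betterLoad : Solution I → Fin n1 → Fin n2 → ℕ
  betterLoad S i j = masked (inS I i j) (xa I S i)

  aboveL : Solution I → Fin n1 → Fin n3 → ℕ
  aboveL S i k = masked (inD I i k) (rowX I S k)

  aboveP : Solution I → Fin n1 → Fin n2 → ℕ
  aboveP S i j = masked (inT I i j) (λ i' → xa I S i' j)

  module Loads (S : Solution I) (M : Pairs I) (rep : Represents S M) where

    sumP≡cntP : ∀ j → sumP I S j ≡ cntP I M j
    sumP≡cntP j = sum-cong λ i → rep i j

    rowX≡rowL : ∀ k i → rowX I S k i ≡ rowL I M k i
    rowX≡rowL k i = sum-cong λ j → trans (cong (b2n (offeredBy I j k) *_) (rep i j)) (sym (b2n-∧ (offeredBy I j k) (M i j)))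

    sumLX≡cntL : ∀ k → sumLX I S k ≡ cntL I M k
    sumLX≡cntL k = sum-cong (rowX≡rowL k)

    objective≡size : objective I S ≡ size I M
    objective≡size = sum-cong λ i → sum-cong (rep i)

    assigned-pos : ∀ {i j} → M i j ≡ true → 0 < xa I S i j
    assigned-pos {i} {j} m = subst (0 <_) (sym (trans (rep i j) (cong b2n m))) (s≤s z≤n)

    pos-assigned : ∀ {i j} → 0 < xa I S i j → M i j ≡ true
    pos-assigned {i} {j} pos = b2n-pos (subst (0 <_) (rep i j) pos)

    rowX-pos : ∀ {k w} → InML I M k w → 0 < rowX I S k w
    rowX-pos {k} {w} (j , e , m) = NP.<-≤-trans
      (subst (λ b → 0 < b2n b * xa I S w j) (sym (offeredBy-true e))
             (subst (0 <_) (sym (NP.*-identityˡ _)) (assigned-pos m)))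
      (term≤sum (λ j' → b2n (offeredBy I j' k) * xa I S w j') j)

    rowX-pos⁻ : ∀ {k w} → 0 < rowX I S k w → InML I M k w
    rowX-pos⁻ {k} {w} pos =
      let (j , term) = sum-pos pos ; (offered , x-pos) = masked-term-pos (offeredBy I j k) _ term
      in j , does-true (offers j F.≟ k) offered , pos-assigned x-pos

  module Conditions (S : Solution I) (M : Pairs I) (rep : Represents S M) (isM : IsMatching I M) where
    open Loads S M rep
    open IsMatching isM

    covets⇒betterLoad≡0 : ∀ {i j} → Covets M i j → betterLoad S i j ≡ 0
    covets⇒betterLoad≡0 {i} {j} cov = masked≡0⁺ (inS I i j) (xa I S i) λ j' better pos → excluded cov better (pos-assigned pos)
      where
      excluded : ∀ {j'} → Covets M i j → inS I i j j' ≡ true → M i j' ≡ true → ⊥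
      excluded (inj₁ unassigned) _ m = contradiction (trans (sym m) (unassigned _)) λ ()
      excluded (inj₂ (j'' , m'' , le)) better m with oneEach i _ j'' m m''
      ... | refl = contradiction (trans (sym better) (not-ranked-above (acc i) (slev i) (acc i j'') le)) λ ()

    betterLoad≡0⇒covets : ∀ {i j} → betterLoad S i j ≡ 0 → Covets M i j
    betterLoad≡0⇒covets {i} {j} none with FP.any? (λ j' → M i j' BP.≟ true)
    ... | no  unassigned = inj₁ λ j' → not-true λ m → unassigned (j' , m)
    ... | yes (j' , m)   = inj₂ (j' , m , level-≤ (acc i) (slev i) accepted accepted notBetter)
      where
      accepted : acc i j' ≡ true
      accepted = acceptable i j' m
      notBetter : inS I i j j' ≡ false
      notBetter = not-true λ better → masked≡0⁻ (inS I i j) (xa I S i) none better (assigned-pos m)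

    not-above⇒aboveL< : ∀ {i k w} → InML I M k w → inD I i k w ≡ false → aboveL S i k < sumLX I S k
    not-above⇒aboveL< {i} {k} w∈ notAbove = masked-<⁺ (inD I i k) (rowX I S k) notAbove (rowX-pos w∈)

    aboveL<⇒not-above : ∀ {i k} → aboveL S i k < sumLX I S k → Σ (Fin n1) λ w → InML I M k w × inD I i k w ≡ false
    aboveL<⇒not-above {i} {k} lt =
      let (w , notAbove , pos) = masked-<⁻ (inD I i k) (rowX I S k) lt in w , rowX-pos⁻ pos , notAbove

    not-above⇒aboveP< : ∀ {i j w} → M w j ≡ true → inT I i j w ≡ false → aboveP S i j < sumP I S j
    not-above⇒aboveP< {i} {j} m notAbove = masked-<⁺ (inT I i j) (λ i' → xa I S i' j) notAbove (assigned-pos m)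

    aboveP<⇒not-above : ∀ {i j} → aboveP S i j < sumP I S j → Σ (Fin n1) λ w → M w j ≡ true × inT I i j w ≡ false
    aboveP<⇒not-above {i} {j} lt =
      let (w , notAbove , pos) = masked-<⁻ (inT I i j) (λ i' → xa I S i' j) lt in w , pos-assigned pos , notAbove

    clause-ii⇒not-above : ∀ {i k} → InML I M k i ⊎ AtLeastWorst I k (InML I M k) i →
                          Σ (Fin n1) λ w → InML I M k w × inD I i k w ≡ false
    clause-ii⇒not-above {i} {k} (inj₁ i∈) = i , i∈ , not-ranked-above (inL I k) (llev k) (inL I k i) NP.≤-refl
    clause-ii⇒not-above {i} {k} (inj₂ (w , w∈ , _ , le)) = w , w∈ , not-ranked-above (inL I k) (llev k) (inL I k w) le

    not-above⇒clause-ii : ∀ {i k w} → InML I M k w → inD I i k w ≡ false → AtLeastWorst I k (InML I M k) i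
    not-above⇒clause-ii {k = k} {w} w∈ notAbove = atLeastWorst-intro in-lecturer? w∈ (level-≤ (inL I k) (llev k) inL-w inL-w notAbove)
      where
      inL-w : inL I k w ≡ true
      inL-w = inL-of-assigned isM w∈
      in-lecturer? : Decidable (InML I M k)
      in-lecturer? w' = FP.any? λ j → (offers j F.≟ k) ×-dec (M w' j BP.≟ true)

    clause-iii⇒not-above : ∀ {i j} → AtLeastWorst I (offers j) (InMP I M j) i →
                           Σ (Fin n1) λ w → M w j ≡ true × inT I i j w ≡ false
    clause-iii⇒not-above {j = j} (w , m , _ , le) = w , m , not-ranked-above (inL I (offers j)) (llev (offers j)) (acc w j) le

    not-above⇒clause-iii : ∀ {i j w} → M w j ≡ true → inT I i j w ≡ false → AtLeastWorst I (offers j) (InMP I M j) i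
    not-above⇒clause-iii {j = j} {w} m notAbove = atLeastWorst-intro (λ w' → M w' j BP.≟ true) m
      (level-≤ (inL I (offers j)) (llev (offers j)) (inL-of-assigned isM (j , refl , m)) (acceptable w j m) notAbove)

    -- Hence clauses (ii) and (iii) are exactly the strict inequalities linearised by δ and λ.
    clause-ii⇒aboveL< : ∀ {i k} → InML I M k i ⊎ AtLeastWorst I k (InML I M k) i → aboveL S i k < sumLX I S k
    clause-ii⇒aboveL< clause = let (w , w∈ , notAbove) = clause-ii⇒not-above clause in not-above⇒aboveL< w∈ notAbove

    aboveL<⇒clause-ii : ∀ {i k} → aboveL S i k < sumLX I S k → AtLeastWorst I k (InML I M k) i
    aboveL<⇒clause-ii lt = let (w , w∈ , notAbove) = aboveL<⇒not-above lt in not-above⇒clause-ii w∈ notAbove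

    clause-iii⇒aboveP< : ∀ {i j} → AtLeastWorst I (offers j) (InMP I M j) i → aboveP S i j < sumP I S j
    clause-iii⇒aboveP< clause = let (w , m , notAbove) = clause-iii⇒not-above clause in not-above⇒aboveP< m notAbove

    aboveP<⇒clause-iii : ∀ {i j} → aboveP S i j < sumP I S j → AtLeastWorst I (offers j) (InMP I M j) i
    aboveP<⇒clause-iii lt = let (w , m , notAbove) = aboveP<⇒not-above lt in not-above⇒clause-iii m notAbove

  feasible⇒matching : (S : Solution I) → Feasible I S → IsMatching I (matchingOf I S)
  feasible⇒matching S feasible = record
    { acceptable = λ i j m → proj₁ (∧-true m)
    ; oneEach    = λ i → sum≤1⇒atMostOne (matchingOf I S i) (studentC i)
    ; projCap    = projectC
    ; lectCap    = λ k → subst (_≤ lcap k) (Loads.sumLX≡cntL S (matchingOf I S) (λ _ _ → refl) k) (lecturerC k) }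
    where open Feasible feasible

  feasible⇒superStable : (S : Solution I) → Feasible I S → SuperStable I (matchingOf I S)
  feasible⇒superStable S feasible = isM , no-blocking
    where
    M : Pairs I
    M = matchingOf I S
    isM : IsMatching I M
    isM = feasible⇒matching S feasible
    rep : Represents S M
    rep _ _ = refl
    open Solution S
    open Loads S M rep
    open Conditions S M rep isM

    no-blocking : ∀ i j → acc i j ≡ true → M i j ≡ false → ¬ Blocks I M i j
    no-blocking i j a unmatched (covets , accepts) = violated (Feasible.pairC feasible i j a) accepts
      where
      k : Fin n3
      k = offers j
      θ≡1 : θ I S i j ≡ + 1
      θ≡1 = cong₂ (λ m n → (+ 1 ℤ.- + m) ℤ.- + n) (cong b2n unmatched) (covets⇒betterLoad≡0 covets)

      -- Each case of (b) forces the indicators of one θ-constraint to 1, which θ = 1 violates.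
      violated : PairConstraints I S i j → WouldAccept M i j → ⊥
      violated (c1 , c2 , c3 , _) (inj₁ (p< , l<)) = bits3-violated θ≡1
        (indicator-forced (cap j) (cap j) (sumP I S j) (α j) c1 p<)
        (indicator-forced (lcap k) (lcap k) (sumLX I S k) (β k) c2 (subst (_< lcap k) (sym (sumLX≡cntL k)) l<)) c3
      violated (c1 , _ , _ , c4 , c5 , c6 , _) (inj₂ (inj₁ (p< , full , clause))) = bits4-violated θ≡1
        (indicator-forced (cap j) (cap j) (sumP I S j) (α j) c1 p<)
        (indicator-forced (lcap k) (suc (sumLX I S k)) (lcap k) (η k) c4 (saturated (trans (sumLX≡cntL k) full)))
        (indicator-forced (lcap k) (sumLX I S k) (aboveL S i k) (δ i k) c5 (clause-ii⇒aboveL< clause)) c6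
      violated (_ , _ , _ , _ , _ , _ , c7 , c8 , c9) (inj₂ (inj₂ (full , clause))) = bits3-violated θ≡1
        (indicator-forced (cap j) (suc (sumP I S j)) (cap j) (γ j) c7 (saturated full))
        (indicator-forced (cap j) (sumP I S j) (aboveP S i j) (λv i j) c8 (clause-iii⇒aboveP< clause)) c9

  -- The 0/1 vector x = M; the sums of J depend on x only.
  loadOf : Pairs I → Solution I
  loadOf M = record { x = M ; α = λ _ → false ; γ = λ _ → false ; β = λ _ → false ; η = λ _ → false
                    ; δ = λ _ _ → false ; λv = λ _ _ → false }

  solutionOf : Pairs I → Solution I
  solutionOf M = record
    { x  = M
    ; α  = λ j → does (sumP I L j <? cap j)
    ; β  = λ k → does (sumLX I L k <? lcap k)
    ; γ  = λ j → does (cap j <? suc (sumP I L j))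
    ; η  = λ k → does (lcap k <? suc (sumLX I L k))
    ; δ  = λ i k → does (aboveL L i k <? sumLX I L k)
    ; λv = λ i j → does (aboveP L i j <? sumP I L j) }
    where L = loadOf M

  module FromMatching (M : Pairs I) (superStable : SuperStable I M) where
    private
      isM : IsMatching I M
      isM = proj₁ superStable
      stable : ∀ i j → acc i j ≡ true → M i j ≡ false → ¬ Blocks I M i j
      stable = proj₂ superStable
      S : Solution I
      S = solutionOf M
    open IsMatching isM

    represents : Represents S M
    represents i j with M i j in m
    ... | true  = cong (λ a → b2n (a ∧ true)) (acceptable i j m)
    ... | false = cong b2n (BP.∧-zeroʳ (acc i j))

    open Loads S M represents
    open Conditions S M represents isM

    projectLoad : ∀ j → sumP I S j ≤ cap j
    projectLoad j = subst (_≤ cap j) (sym (sumP≡cntP j)) (projCap j)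

    lecturerLoad : ∀ k → sumLX I S k ≤ lcap k
    lecturerLoad k = subst (_≤ lcap k) (sym (sumLX≡cntL k)) (lectCap k)

    studentLoad≤1 : ∀ i → sumℕ (λ j → xa I S i j) ≤ 1
    studentLoad≤1 i = subst (_≤ 1) (sym (sum-cong (represents i))) (atMostOne⇒sum≤1 (M i) (oneEach i))

    module Pair (i : Fin n1) (j : Fin n2) (a : acc i j ≡ true) where
      k : Fin n3
      k = offers j
      open Solution S

      uncovered : Bool
      uncovered = does (xa I S i j + betterLoad S i j ℕ.≟ 0)

      θ≡uncovered : θ I S i j ≡ b2z uncovered
      θ≡uncovered = θ-bit (xa I S i j) (betterLoad S i j) (NP.≤-trans (masked-split (inS I i j) (xa I S i) irreflexive) (studentLoad≤1 i))
        where
        irreflexive : inS I i j j ≡ false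
        irreflexive = not-ranked-above (acc i) (slev i) (acc i j) NP.≤-refl

      rejects : uncovered ≡ true → ¬ WouldAccept M i j
      rejects set = let (x≡0 , better≡0) = θ-bit-set _ _ set in
        λ accepts → stable i j a (b2n≡0 x≡0) (betterLoad≡0⇒covets better≡0 , accepts)
        where
        b2n≡0 : xa I S i j ≡ 0 → M i j ≡ false
        b2n≡0 x≡0 = not-true λ m → NP.<-irrefl (sym x≡0) (assigned-pos m)

      project-slack : α j ≡ true → cntP I M j < cap j
      project-slack set = subst (_< cap j) (sumP≡cntP j) (does-true (_ <? cap j) set)

      lecturer-slack : β k ≡ true → cntL I M k < lcap k
      lecturer-slack set = subst (_< lcap k) (sumLX≡cntL k) (does-true (_ <? lcap k) set)

      lecturer-full : η k ≡ true → cntL I M k ≡ lcap k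
      lecturer-full set = NP.≤-antisym (lectCap k)
        (subst (lcap k ≤_) (sumLX≡cntL k) (NP.≤-pred (does-true (lcap k <? _) set)))

      project-full : γ j ≡ true → cntP I M j ≡ cap j
      project-full set = NP.≤-antisym (projCap j)
        (subst (cap j ≤_) (sumP≡cntP j) (NP.≤-pred (does-true (cap j <? _) set)))

      -- The six big-M constraints hold by the choice of the indicators; the three
      -- θ-constraints hold since θ = 1 together with their indicators would be a blocking pair.
      constraints : PairConstraints I S i j
      constraints =
          indicator-sound (cap j) (cap j) (sumP I S j) (NP.m∸n≤m (cap j) (sumP I S j)) (_ <? _)
        , indicator-sound (lcap k) (lcap k) (sumLX I S k) (NP.m∸n≤m (lcap k) (sumLX I S k)) (_ <? _)
        , subst (λ t → t ℤ.+ b2z (α j) ℤ.+ b2z (β k) ℤ.≤ + 2) (sym θ≡uncovered)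
            (bits3-≤ _ _ _ λ set α-set β-set → rejects set (inj₁ (project-slack α-set , lecturer-slack β-set)))
        , indicator-sound (lcap k) (suc (sumLX I S k)) (lcap k) (overflow-bound (lcap-pos k) (lecturerLoad k)) (_ <? _)
        , indicator-sound (lcap k) (sumLX I S k) (aboveL S i k) (NP.≤-trans (NP.m∸n≤m (sumLX I S k) (aboveL S i k)) (lecturerLoad k)) (_ <? _)
        , subst (λ t → t ℤ.+ b2z (α j) ℤ.+ b2z (η k) ℤ.+ b2z (δ i k) ℤ.≤ + 3) (sym θ≡uncovered)
            (bits4-≤ _ _ _ _ λ set α-set η-set δ-set → rejects set (inj₂ (inj₁
              (project-slack α-set , lecturer-full η-set ,
               inj₂ (aboveL<⇒clause-ii (does-true (_ <? _) δ-set))))))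
        , indicator-sound (cap j) (suc (sumP I S j)) (cap j) (overflow-bound (cap-pos j) (projectLoad j)) (_ <? _)
        , indicator-sound (cap j) (sumP I S j) (aboveP S i j) (NP.≤-trans (NP.m∸n≤m (sumP I S j) (aboveP S i j)) (projectLoad j)) (_ <? _)
        , subst (λ t → t ℤ.+ b2z (γ j) ℤ.+ b2z (λv i j) ℤ.≤ + 2) (sym θ≡uncovered)
            (bits3-≤ _ _ _ λ set γ-set λ-set → rejects set (inj₂ (inj₂
              (project-full γ-set ,
               aboveP<⇒clause-iii (does-true (_ <? _) λ-set)))))

    feasible : Feasible I S
    feasible = record
      { studentC  = studentLoad≤1
      ; projectC  = projectLoad
      ; lecturerC = lecturerLoad
      ; pairC     = Pair.constraints }

theorem4 : (I : Instance) →
    ((S : Solution I) → Feasible I S →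
        SuperStable I (matchingOf I S) × (size I (matchingOf I S) ≡ objective I S))
    ×
    ((M : Pairs I) → SuperStable I M →
        Σ (Solution I) λ S → Feasible I S
          × (∀ i j → Instance.acc I i j ≡ true → Solution.x S i j ≡ M i j)
          × (objective I S ≡ size I M))
theorem4 I =
    (λ S feasible → feasible⇒superStable I S feasible , refl)
  , (λ M superStable → let open FromMatching I M superStable in
       solutionOf I M , feasible , (λ _ _ _ → refl) , Loads.objective≡size I (solutionOf I M) M represents)
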